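{- Let $q$ be a prime power, let $m,n,k$ be positive integers, let $\rho$ be a positive integer, let $\mathcal{U}$ be an $[n,k]_{q^m/q}$ system and let $\{u_1,\ldots,u_n\}$ be an $\mathbb{F}_q$-basis of $\mathcal{U}$. The following are equivalent: (a) $\mathcal{U}$ is rank-$\rho$-saturating. (b) For each vector $v\in \mathbb{F}_{q^m}^k$ there exists $\lambda=(\lambda_1,\ldots,\lambda_n)\in \mathbb{F}_{q^m}^{1\times n}$ with $\mathrm{wt}_{\mathrm{rk}}(\lambda)\le \rho$ such that $v=\lambda_1 u_1+\cdots+\lambda_n u_n$, and $\rho$ is the smallest integer with this property. (c) $\mathbb{F}_{q^m}^k=\bigcup_{\mathcal{S}} \langle \mathcal{S}\rangle_{\mathbb{F}_{q^m}}$, where the union runs over all $\mathbb{F}_q$-subspaces $\mathcal{S}\le \mathcal{U}$ with $\dim_{\mathbb{F}_q}\mathcal{S}\le \rho$, and $\rho$ is the smallest integer with this property.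
   Context: For $x=(x_1,\ldots,x_n)\in\mathbb{F}_{q^m}^{1\times n}$, the rank weight is $\mathrm{wt}_{\mathrm{rk}}(x)=\dim_{\mathbb{F}_q}\langle x_1,\ldots,x_n\rangle_{\mathbb{F}_q}$. An $[n,k]_{q^m/q}$ system is an $n$-dimensional $\mathbb{F}_q$-subspace $\mathcal{U}\le\mathbb{F}_{q^m}^k$ with $\langle\mathcal{U}\rangle_{\mathbb{F}_{q^m}}=\mathbb{F}_{q^m}^k$. Its linear set is $L_\mathcal{U}=\{\langle u\rangle_{\mathbb{F}_{q^m}}: u\in\mathcal{U}\setminus\{0\}\}\subseteq \mathrm{PG}(k-1,q^m)$. For an integer $r\ge 0$, a set $\mathcal{S}$ of points of $\mathrm{PG}(k-1,q^m)$ is $r$-saturating if every point of $\mathrm{PG}(k-1,q^m)$ lies in the projective subspace spanned by some $r+1$ points of $\mathcal{S}$, and $r$ is the smallest integer with this property. The system $\mathcal{U}$ is rank-$\rho$-saturating if $L_\mathcal{U}$ is a $(\rho-1)$-saturating set of $\mathrm{PG}(k-1,q^m)$. -}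

module Defs where

open import Level using (0ℓ)
open import Algebra.Bundles using (CommutativeRing)
open import Data.Nat using (ℕ; zero; suc; _≤_; _<_; _^_; _∸_)
open import Data.Nat.Primality using (Prime)
open import Data.Fin using (Fin) renaming (zero to fzero; suc to fsuc)
open import Data.Product using (Σ; ∃; ∃₂; _×_; _,_)
open import Relation.Nullary using (¬_)
open import Relation.Binary.PropositionalEquality using (_≡_)

IsPrimePower : ℕ → Set
IsPrimePower q = ∃₂ λ p e → Prime p × q ≡ p ^ suc e

-- Generic linear-algebra notions inside a commutative ring R, with the
-- coefficients restricted by a predicate P (P = "lies in F_q" for
-- F_q-linear notions, P = everything for F_{q^m}-linear notions).

module Lin (R : CommutativeRing 0ℓ 0ℓ) where
  open CommutativeRing R hiding (zero)

  ∑ : ∀ {n} → (Fin n → Carrier) → Carrier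
  ∑ {zero}  f = 0#
  ∑ {suc n} f = f fzero + ∑ (λ i → f (fsuc i))

  Vec : ℕ → Set
  Vec k = Fin k → Carrier

  _≈ᵥ_ : ∀ {k} → Vec k → Vec k → Set
  v ≈ᵥ w = ∀ j → v j ≈ w j

  NonZeroᵥ : ∀ {k} → Vec k → Set
  NonZeroᵥ v = ¬ (∀ j → v j ≈ 0#)

  lc : ∀ {n} → (Fin n → Carrier) → (Fin n → Carrier) → Carrier
  lc c w = ∑ (λ i → c i * w i)

  lcᵥ : ∀ {n k} → (Fin n → Carrier) → (Fin n → Vec k) → Vec k
  lcᵥ c w j = ∑ (λ i → c i * w i j)

  InSpan : (Carrier → Set) → ∀ {n} → (Fin n → Carrier) → Carrier → Set
  InSpan P {n} w x = Σ (Fin n → Carrier) λ c → (∀ i → P (c i)) × (x ≈ lc c w)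

  InSpanᵥ : (Carrier → Set) → ∀ {n k} → (Fin n → Vec k) → Vec k → Set
  InSpanᵥ P {n} w v = Σ (Fin n → Carrier) λ c → (∀ i → P (c i)) × (v ≈ᵥ lcᵥ c w)

  Indep : (Carrier → Set) → ∀ {n} → (Fin n → Carrier) → Set
  Indep P {n} w = (c : Fin n → Carrier) → (∀ i → P (c i)) →
                  lc c w ≈ 0# → ∀ i → c i ≈ 0#

  Indepᵥ : (Carrier → Set) → ∀ {n k} → (Fin n → Vec k) → Set
  Indepᵥ P {n} w = (c : Fin n → Carrier) → (∀ i → P (c i)) →
                   lcᵥ c w ≈ᵥ (λ _ → 0#) → ∀ i → c i ≈ 0#

-- A field extension F_{q^m} / F_q:  K is a field, F ⊆ K (predicate inF)
-- is a subfield with exactly q elements, and K has an F-basis of size m.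

record FieldExt (q m : ℕ) : Set₁ where
  field
    K : CommutativeRing 0ℓ 0ℓ
  open CommutativeRing K public hiding (zero)
  open Lin K public
  field
    0≉1      : ¬ (0# ≈ 1#)
    inverse  : ∀ x → ¬ (x ≈ 0#) → ∃ λ y → x * y ≈ 1#
    inF      : Carrier → Set
    inF-resp : ∀ {x y} → x ≈ y → inF x → inF y
    inF-0    : inF 0#
    inF-1    : inF 1#
    inF-+    : ∀ {x y} → inF x → inF y → inF (x + y)
    inF-neg  : ∀ {x} → inF x → inF (- x)
    inF-*    : ∀ {x y} → inF x → inF y → inF (x * y)
    inF-inv  : ∀ {x} → inF x → ¬ (x ≈ 0#) → ∃ λ y → inF y × (x * y ≈ 1#)
    enumF      : Fin q → Carrier
    enumF-inF  : ∀ i → inF (enumF i)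
    enumF-surj : ∀ x → inF x → ∃ λ i → enumF i ≈ x
    enumF-inj  : ∀ i j → enumF i ≈ enumF j → i ≡ j
    basisK       : Fin m → Carrier
    basisK-indep : Indep inF basisK
    basisK-span  : ∀ x → InSpan inF basisK x

-- Notions of the paper, for an [n,k]_{q^m/q} system U given by an
-- F_q-basis u_1..u_n (so U = F_q-span of u).

module _ {q m : ℕ} (E : FieldExt q m) where
  open FieldExt E

  AnyK : Carrier → Set
  AnyK _ = Carrier   -- trivially inhabited: no restriction on coefficients

  InU : ∀ {n k} → (Fin n → Vec k) → Vec k → Set
  InU u x = InSpanᵥ inF u x

  IsSystemBasis : ∀ {n k} → (Fin n → Vec k) → Set
  IsSystemBasis {n} {k} u = Indepᵥ inF u × (∀ (v : Vec k) → InSpanᵥ AnyK u v)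

  RankWt : ∀ {n} → (Fin n → Carrier) → ℕ → Set
  RankWt {n} λ' d = Σ (Fin d → Carrier) λ e →
      Indep inF e × (∀ j → InSpan inF λ' (e j)) × (∀ i → InSpan inF e (λ' i))

  -- L_U is r-saturating-or-better: every point ⟨v⟩ of PG(k-1,q^m) (v ≠ 0)
  -- lies in the projective subspace spanned by some r+1 points ⟨w_i⟩ of L_U
  -- (w_i ∈ U ∖ {0}).
  SpansWith : ∀ {n k} → (Fin n → Vec k) → ℕ → Set
  SpansWith {n} {k} u r = ∀ (v : Vec k) → NonZeroᵥ v →
      Σ (Fin (suc r) → Vec k) λ w →
        (∀ i → InU u (w i) × NonZeroᵥ (w i)) × InSpanᵥ AnyK w v

  Saturating : ∀ {n k} → (Fin n → Vec k) → ℕ → Set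
  Saturating u r = SpansWith u r × (∀ r' → r' < r → ¬ SpansWith u r')

  -- U is rank-ρ-saturating : L_U is (ρ-1)-saturating
  RankSaturating : ∀ {n k} → (Fin n → Vec k) → ℕ → Set
  RankSaturating u ρ = Saturating u (ρ ∸ 1)

  PropB : ∀ {n k} → (Fin n → Vec k) → ℕ → Set
  PropB {n} {k} u r = ∀ (v : Vec k) →
      Σ (Fin n → Carrier) λ λ' → Σ ℕ λ d →
        d ≤ r × RankWt λ' d × (v ≈ᵥ lcᵥ λ' u)

  PropC : ∀ {n k} → (Fin n → Vec k) → ℕ → Set
  PropC {n} {k} u r = ∀ (v : Vec k) → Σ ℕ λ d → d ≤ r ×
      Σ (Fin d → Vec k) λ s →
        Indepᵥ inF s × (∀ j → InU u (s j)) × InSpanᵥ AnyK s v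

  Least : (ℕ → Set) → ℕ → Set
  Least P ρ = P ρ × (∀ ρ' → ρ' < ρ → ¬ P ρ')

module Submission where

-- All three properties say that each v is an F_{q^m}-combination of vectors of U with a small
-- F_q-span; they only measure that span differently: by a number of points of L_U (a), by the
-- F_q-rank of the coefficients in the basis u (b), or by the dimension of a subspace of U (c).
-- Translating between the descriptions never increases the measure, because any finite family
-- contains an F_q-basis of its span (decidable, F_q being finite) and an independent family inside
-- the F_q-span of d vectors has at most d members (Steinitz, proved by counting F_q-combinations).
-- Hence the properties hold for the same bounds, so their least bounds agree; (a) is shifted by one
-- since L_U is (ρ-1)-saturating, and bound 0 is impossible because k ≥ 1.

open import Level using (0ℓ)
open import Algebra.Bundles using (CommutativeRing)
open import Defs
open import Data.Nat using (ℕ; zero; suc; _≤_; _<_; z≤n; s≤s; _^_)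
open import Data.Nat.Properties using (≮⇒≥; <⇒≱; ^-monoʳ-<; ≤-refl; ≤-trans; m≤n⇒m≤1+n)
open import Data.Fin using (Fin; funToFin; finToFun; combine)
  renaming (zero to fzero; suc to fsuc)
open import Data.Fin.Properties
  using (_≟_; all?; any?; injective⇒≤; finToFun-funToFin; funToFin-finToFin)
open import Data.Vec.Functional using (_∷_)
open import Data.Product using (Σ; ∃; _×_; _,_; proj₁; proj₂)
open import Data.Empty using (⊥-elim)
open import Function using (_∘_; _⇔_; mk⇔; Equivalence)
open import Function.Properties.Equivalence using () renaming (trans to ⇔-trans; sym to ⇔-sym)
open import Relation.Nullary using (¬_; Dec; yes; no)
open import Relation.Nullary.Decidable using (map′)
open import Relation.Binary.PropositionalEquality as ≡ using (_≡_; _≢_; _≗_)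

funToFin-cong : ∀ {a b} {f g : Fin a → Fin b} → f ≗ g → funToFin f ≡ funToFin g
funToFin-cong {zero}  f≗g = ≡.refl
funToFin-cong {suc a} f≗g = ≡.cong₂ combine (f≗g fzero) (funToFin-cong (f≗g ∘ fsuc))

^-≤-by-injection : ∀ {q N d} (φ : (Fin N → Fin q) → (Fin d → Fin q)) →
                   (∀ t t′ → φ t ≗ φ t′ → t ≗ t′) → q ^ N ≤ q ^ d
^-≤-by-injection {q} {N} {d} φ φ-injective = injective⇒≤ φ̂-injective
  where
  decode : Fin (q ^ N) → Fin N → Fin q
  decode = finToFun

  φ̂ : Fin (q ^ N) → Fin (q ^ d)
  φ̂ = funToFin ∘ φ ∘ decode

  φ̂-injective : ∀ {x y} → φ̂ x ≡ φ̂ y → x ≡ y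
  φ̂-injective {x} {y} φ̂x≡φ̂y = begin
    x                   ≡⟨ funToFin-finToFin {N} {q} x ⟨
    funToFin (decode x) ≡⟨ funToFin-cong (φ-injective _ _ same-image) ⟩
    funToFin (decode y) ≡⟨ funToFin-finToFin {N} {q} y ⟩
    y                   ∎
    where
    open ≡.≡-Reasoning
    same-image : φ (decode x) ≗ φ (decode y)
    same-image l = begin
      φ (decode x) l      ≡⟨ finToFun-funToFin (φ (decode x)) l ⟨
      finToFun (φ̂ x) l    ≡⟨ ≡.cong (λ z → finToFun z l) φ̂x≡φ̂y ⟩
      finToFun (φ̂ y) l    ≡⟨ finToFun-funToFin (φ (decode y)) l ⟩
      φ (decode y) l      ∎

^-cancelʳ-≤ : ∀ q {N d} → 1 < q → q ^ N ≤ q ^ d → N ≤ d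
^-cancelʳ-≤ q 1<q qᴺ≤qᵈ = ≮⇒≥ (λ d<N → <⇒≱ (^-monoʳ-< q 1<q d<N) qᴺ≤qᵈ)

distinct⇒1<n : ∀ {n} {a b : Fin n} → a ≢ b → 1 < n
distinct⇒1<n {suc zero}    {fzero} {fzero} a≢b = ⊥-elim (a≢b ≡.refl)
distinct⇒1<n {suc (suc n)}                 _   = s≤s (s≤s z≤n)

pad : ∀ {A : Set} {d r} → d ≤ r → (Fin d → A) → A → Fin r → A
pad z≤n       f x _        = x
pad (s≤s d≤r) f x fzero    = f fzero
pad (s≤s d≤r) f x (fsuc i) = pad d≤r (f ∘ fsuc) x i

pad-all : ∀ {A : Set} {d r} (P : A → Set) (d≤r : d ≤ r) {f : Fin d → A} {x : A} →
          (∀ j → P (f j)) → P x → ∀ i → P (pad d≤r f x i)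
pad-all P z≤n       Pf Px i        = Px
pad-all P (s≤s d≤r) Pf Px fzero    = Pf fzero
pad-all P (s≤s d≤r) Pf Px (fsuc i) = pad-all P d≤r (Pf ∘ fsuc) Px i

module LinearCombinations (R : CommutativeRing 0ℓ 0ℓ) where
  open CommutativeRing R hiding (zero)
  open Lin R
  open import Algebra.Properties.Semiring.Sum semiring as Sum using (sum)
  open import Algebra.Properties.Ring ring using (-1*x≈-x; -‿distribˡ-*)
  open import Relation.Binary.Reasoning.Setoid setoid

  ∑≡sum : ∀ {n} (f : Fin n → Carrier) → ∑ f ≡ sum f
  ∑≡sum {zero}  f = ≡.refl
  ∑≡sum {suc n} f = ≡.cong (f fzero +_) (∑≡sum (f ∘ fsuc))

  ∑-cong : ∀ {n} {f g : Fin n → Carrier} → (∀ i → f i ≈ g i) → ∑ f ≈ ∑ g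
  ∑-cong {f = f} {g} f≈g = begin
    ∑ f   ≡⟨ ∑≡sum f ⟩
    sum f ≈⟨ Sum.sum-cong-≋ f≈g ⟩
    sum g ≡⟨ ∑≡sum g ⟨
    ∑ g   ∎

  ∑-zero : ∀ {n} {f : Fin n → Carrier} → (∀ i → f i ≈ 0#) → ∑ f ≈ 0#
  ∑-zero {n} {f} f≈0 = begin
    ∑ f                ≈⟨ ∑-cong f≈0 ⟩
    ∑ {n} (λ _ → 0#)   ≡⟨ ∑≡sum {n} (λ _ → 0#) ⟩
    sum {n} (λ _ → 0#) ≈⟨ Sum.sum-replicate-zero n ⟩
    0#             ∎

  ∑-distrib-+ : ∀ {n} (f g : Fin n → Carrier) → ∑ (λ i → f i + g i) ≈ ∑ f + ∑ g
  ∑-distrib-+ f g = begin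
    ∑ (λ i → f i + g i)   ≡⟨ ∑≡sum (λ i → f i + g i) ⟩
    sum (λ i → f i + g i) ≈⟨ Sum.∑-distrib-+ f g ⟩
    sum f + sum g         ≡⟨ ≡.cong₂ _+_ (∑≡sum f) (∑≡sum g) ⟨
    ∑ f + ∑ g             ∎

  *-distribˡ-∑ : ∀ {n} x (f : Fin n → Carrier) → x * ∑ f ≈ ∑ (λ i → x * f i)
  *-distribˡ-∑ x f = begin
    x * ∑ f             ≡⟨ ≡.cong (x *_) (∑≡sum f) ⟩
    x * sum f           ≈⟨ Sum.*-distribˡ-sum x f ⟩
    sum (λ i → x * f i) ≡⟨ ∑≡sum (λ i → x * f i) ⟨
    ∑ (λ i → x * f i)   ∎

  *-distribʳ-∑ : ∀ {n} x (f : Fin n → Carrier) → ∑ f * x ≈ ∑ (λ i → f i * x)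
  *-distribʳ-∑ x f = begin
    ∑ f * x             ≡⟨ ≡.cong (_* x) (∑≡sum f) ⟩
    sum f * x           ≈⟨ Sum.*-distribʳ-sum x f ⟩
    sum (λ i → f i * x) ≡⟨ ∑≡sum (λ i → f i * x) ⟨
    ∑ (λ i → f i * x)   ∎

  -‿distrib-∑ : ∀ {n} (f : Fin n → Carrier) → - ∑ f ≈ ∑ (λ i → - f i)
  -‿distrib-∑ f = begin
    - ∑ f                  ≈⟨ -1*x≈-x (∑ f) ⟨
    - 1# * ∑ f             ≈⟨ *-distribˡ-∑ (- 1#) f ⟩
    ∑ (λ i → - 1# * f i)   ≈⟨ ∑-cong (λ i → -1*x≈-x (f i)) ⟩
    ∑ (λ i → - f i)        ∎

  ∑-comm : ∀ {n d} (f : Fin n → Fin d → Carrier) →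
           ∑ (λ i → ∑ (f i)) ≈ ∑ (λ j → ∑ (λ i → f i j))
  ∑-comm f = begin
    ∑ (λ i → ∑ (f i))               ≡⟨ ∑∑≡sumsum f ⟩
    sum (λ i → sum (f i))           ≈⟨ Sum.∑-comm f ⟩
    sum (λ j → sum (λ i → f i j))   ≡⟨ ∑∑≡sumsum (λ j i → f i j) ⟨
    ∑ (λ j → ∑ (λ i → f i j))       ∎
    where
    ∑∑≡sumsum : ∀ {a b} (g : Fin a → Fin b → Carrier) →
                ∑ (λ i → ∑ (g i)) ≡ sum (λ i → sum (g i))
    ∑∑≡sumsum g = ≡.trans (∑≡sum (λ i → ∑ (g i))) (Sum.sum-cong-≗ (λ i → ∑≡sum (g i)))

  ∑-closed : (P : Carrier → Set) → P 0# → (∀ {x y} → P x → P y → P (x + y)) →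
             ∀ {n} {f : Fin n → Carrier} → (∀ i → P (f i)) → P (∑ f)
  ∑-closed P P0 P+ {zero}  Pf = P0
  ∑-closed P P0 P+ {suc n} Pf = P+ (Pf fzero) (∑-closed P P0 P+ (Pf ∘ fsuc))

  ∑-*-∑ : ∀ {n d} (x : Fin n → Carrier) (y : Fin n → Fin d → Carrier) (z : Fin d → Carrier) →
          ∑ (λ i → x i * ∑ (λ j → y i j * z j)) ≈ ∑ (λ j → ∑ (λ i → x i * y i j) * z j)
  ∑-*-∑ {n} {d} x y z = begin
    ∑ (λ i → x i * ∑ (λ j → y i j * z j))   ≈⟨ ∑-cong (λ i → *-distribˡ-∑ {d} (x i) _) ⟩
    ∑ (λ i → ∑ (λ j → x i * (y i j * z j))) ≈⟨ ∑-comm {n} {d} _ ⟩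
    ∑ (λ j → ∑ (λ i → x i * (y i j * z j))) ≈⟨ ∑-cong {d} (λ j → ∑-cong {n} (λ i → sym (*-assoc _ _ _))) ⟩
    ∑ (λ j → ∑ (λ i → x i * y i j * z j))   ≈⟨ ∑-cong (λ j → *-distribʳ-∑ {n} (z j) _) ⟨
    ∑ (λ j → ∑ (λ i → x i * y i j) * z j)   ∎

  lcᵥ-cong : ∀ {n k} {c c′ : Fin n → Carrier} (w : Fin n → Vec k) →
             (∀ i → c i ≈ c′ i) → lcᵥ c w ≈ᵥ lcᵥ c′ w
  lcᵥ-cong w c≈c′ t = ∑-cong (λ i → *-congʳ (c≈c′ i))

  lcᵥ-∘ : ∀ {n d k} (c : Fin n → Carrier) {w : Fin n → Vec k}
          (a : Fin n → Fin d → Carrier) (e : Fin d → Vec k) →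
          (∀ i → w i ≈ᵥ lcᵥ (a i) e) → lcᵥ c w ≈ᵥ lcᵥ (λ j → ∑ (λ i → c i * a i j)) e
  lcᵥ-∘ c a e w≈ae t =
    trans (∑-cong (λ i → *-congˡ (w≈ae i t))) (∑-*-∑ c a (λ j → e j t))

  *-lcᵥ : ∀ {n k} x (c : Fin n → Carrier) (w : Fin n → Vec k) t →
          x * lcᵥ c w t ≈ lcᵥ (λ i → x * c i) w t
  *-lcᵥ {n} x c w t =
    trans (*-distribˡ-∑ {n} x _) (∑-cong (λ i → sym (*-assoc x (c i) (w i t))))

  -‿lcᵥ : ∀ {n k} (c : Fin n → Carrier) (w : Fin n → Vec k) t →
          - lcᵥ c w t ≈ lcᵥ (λ i → - c i) w t
  -‿lcᵥ {n} c w t = trans (-‿distrib-∑ {n} _) (∑-cong (λ i → -‿distribˡ-* (c i) (w i t)))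

  lcᵥ-sub : ∀ {n k} (c c′ : Fin n → Carrier) (w : Fin n → Vec k) t →
            lcᵥ (λ i → c i - c′ i) w t ≈ lcᵥ c w t - lcᵥ c′ w t
  lcᵥ-sub {n} c c′ w t = begin
    lcᵥ (λ i → c i - c′ i) w t                         ≈⟨ ∑-cong (λ i → distribʳ (w i t) (c i) (- c′ i)) ⟩
    ∑ (λ i → c i * w i t + - c′ i * w i t)             ≈⟨ ∑-distrib-+ {n} _ _ ⟩
    lcᵥ c w t + lcᵥ (λ i → - c′ i) w t                 ≈⟨ +-congˡ (-‿lcᵥ c′ w t) ⟨
    lcᵥ c w t - lcᵥ c′ w t                             ∎

  lcᵥ-pad : ∀ {d r k} (d≤r : d ≤ r) (c : Fin d → Carrier) (s : Fin d → Vec k) x →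
            lcᵥ (pad d≤r c 0#) (pad d≤r s x) ≈ᵥ lcᵥ c s
  lcᵥ-pad {r = r} z≤n c s x t = ∑-zero {r} (λ _ → zeroˡ _)
  lcᵥ-pad (s≤s d≤r) c s x t = +-congˡ (lcᵥ-pad d≤r (c ∘ fsuc) (s ∘ fsuc) x t)

  δ : ∀ {n} → Fin n → Fin n → Carrier
  δ fzero    fzero    = 1#
  δ fzero    (fsuc _) = 0#
  δ (fsuc _) fzero    = 0#
  δ (fsuc a) (fsuc b) = δ a b

  δ-diagonal : ∀ {n} (a : Fin n) → δ a a ≡ 1#
  δ-diagonal fzero    = ≡.refl
  δ-diagonal (fsuc a) = δ-diagonal a

  lcᵥ-δ : ∀ {n k} (a : Fin n) (w : Fin n → Vec k) → w a ≈ᵥ lcᵥ (δ a) w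
  lcᵥ-δ {suc n} fzero w t = sym (trans (+-cong (*-identityˡ _) (∑-zero {n} (λ _ → zeroˡ _))) (+-identityʳ _))
  lcᵥ-δ (fsuc a) w t = trans (lcᵥ-δ a (w ∘ fsuc) t) (sym (trans (+-congʳ (zeroˡ _)) (+-identityˡ _)))

  module _ (P : Carrier → Set) (P0 : P 0#) where

    δ-closed : P 1# → ∀ {n} (a b : Fin n) → P (δ a b)
    δ-closed P1 fzero    fzero    = P1
    δ-closed P1 fzero    (fsuc _) = P0
    δ-closed P1 (fsuc _) fzero    = P0
    δ-closed P1 (fsuc a) (fsuc b) = δ-closed P1 a b

    InSpanᵥ-member : P 1# → ∀ {n k} (w : Fin n → Vec k) a → InSpanᵥ P w (w a)
    InSpanᵥ-member P1 w a = δ a , δ-closed P1 a , lcᵥ-δ a w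

    InSpanᵥ-tail : ∀ {d k} (w : Fin (suc d) → Vec k) {v} →
                   InSpanᵥ P (w ∘ fsuc) v → InSpanᵥ P w v
    InSpanᵥ-tail w (c , Pc , v≈cw) =
      0# ∷ c , (λ { fzero → P0 ; (fsuc i) → Pc i }) ,
      λ t → trans (v≈cw t) (sym (trans (+-congʳ (zeroˡ _)) (+-identityˡ _)))

  [_] : Carrier → Vec 1
  [ x ] _ = x

  Indepᵥ-[] : ∀ {P n} {w : Fin n → Carrier} → Indepᵥ P ([_] ∘ w) → Indep P w
  Indepᵥ-[] indep c Pc cw≈0 = indep c Pc (λ _ → cw≈0)

  InSpanᵥ-[] : ∀ {P n} {w : Fin n → Carrier} {x} → InSpanᵥ P ([_] ∘ w) [ x ] → InSpan P w x
  InSpanᵥ-[] (c , Pc , x≈cw) = c , Pc , x≈cw fzero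

module FieldExtProperties {q m : ℕ} (E : FieldExt q m) where
  open FieldExt E
  open LinearCombinations K
  open import Algebra.Properties.Ring ring using (-‿distribʳ-*)
  open import Algebra.Properties.Group +-group using (x∙y⁻¹≈ε⇒x≈y; x≈y⇒x∙y⁻¹≈ε; inverseˡ-unique)
  open import Relation.Binary.Reasoning.Setoid setoid

  1<q : 1 < q
  1<q with enumF-surj 0# inF-0 | enumF-surj 1# inF-1
  ... | i₀ , i₀↦0 | i₁ , i₁↦1 = distinct⇒1<n λ i₀≡i₁ →
    0≉1 (trans (sym i₀↦0) (trans (reflexive (≡.cong enumF i₀≡i₁)) i₁↦1))

  inF-≈0? : ∀ {x} → inF x → Dec (x ≈ 0#)
  inF-≈0? {x} x∈F with enumF-surj x x∈F | enumF-surj 0# inF-0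
  ... | i , i↦x | o , o↦0 = map′
    (λ i≡o → trans (sym i↦x) (trans (reflexive (≡.cong enumF i≡o)) o↦0))
    (λ x≈0 → enumF-inj i o (trans i↦x (trans x≈0 (sym o↦0))))
    (i ≟ o)

  ≈0? : ∀ x → Dec (x ≈ 0#)
  ≈0? x with basisK-span x
  ... | c , c∈F , x≈cb = map′
    (λ c≈0 → trans x≈cb (∑-zero (λ i → trans (*-congʳ (c≈0 i)) (zeroˡ _))))
    (λ x≈0 → basisK-indep c c∈F (trans (sym x≈cb) x≈0))
    (all? (λ i → inF-≈0? (c∈F i)))

  _≈?_ : ∀ x y → Dec (x ≈ y)
  x ≈? y = map′ (x∙y⁻¹≈ε⇒x≈y x y) x≈y⇒x∙y⁻¹≈ε (≈0? (x - y))

  _≈ᵥ?_ : ∀ {k} (v w : Vec k) → Dec (v ≈ᵥ w)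
  v ≈ᵥ? w = all? (λ t → v t ≈? w t)

  -- F_q is finite, so membership in an F_q-span is decided by trying all q^d coefficient vectors.
  span? : ∀ {d k} (e : Fin d → Vec k) (v : Vec k) → Dec (InSpanᵥ inF e v)
  span? {d} e v = map′ found exhaustive (any? (λ x → v ≈ᵥ? lcᵥ (coefficients x) e))
    where
    coefficients : Fin (q ^ d) → Fin d → Carrier
    coefficients x = enumF ∘ finToFun x

    found : ∃ (λ x → v ≈ᵥ lcᵥ (coefficients x) e) → InSpanᵥ inF e v
    found (x , v≈xe) = coefficients x , enumF-inF ∘ finToFun x , v≈xe

    exhaustive : InSpanᵥ inF e v → ∃ λ x → v ≈ᵥ lcᵥ (coefficients x) e
    exhaustive (c , c∈F , v≈ce) = funToFin t , λ j → trans (v≈ce j) (lcᵥ-cong e c≈ j)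
      where
      t : Fin d → Fin q
      t i = proj₁ (enumF-surj (c i) (c∈F i))
      c≈ : ∀ i → c i ≈ coefficients (funToFin t) i
      c≈ i = sym (trans (reflexive (≡.cong enumF (finToFun-funToFin t i))) (proj₂ (enumF-surj (c i) (c∈F i))))

  Indepᵥ-∷ : ∀ {d k} (f : Fin (suc d) → Vec k) → Indepᵥ inF (f ∘ fsuc) →
             ¬ InSpanᵥ inF (f ∘ fsuc) (f fzero) → Indepᵥ inF f
  Indepᵥ-∷ {d} f tail-indep head∉span c c∈F cf≈0 with inF-≈0? (c∈F fzero)
  ... | yes c₀≈0 = λ { fzero → c₀≈0 ; (fsuc i) → tail-indep (c ∘ fsuc) (c∈F ∘ fsuc) tail≈0 i }
    where
    tail≈0 : lcᵥ (c ∘ fsuc) (f ∘ fsuc) ≈ᵥ (λ _ → 0#)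
    tail≈0 t = trans (sym (trans (+-congʳ (trans (*-congʳ c₀≈0) (zeroˡ _))) (+-identityˡ _))) (cf≈0 t)
  ... | no c₀≉0 with inF-inv (c∈F fzero) c₀≉0
  ...   | y , y∈F , c₀y≈1 = ⊥-elim (head∉span (c′ , c′∈F , head≈))
    where
    c′ : Fin d → Carrier
    c′ i = - (y * c (fsuc i))
    c′∈F : ∀ i → inF (c′ i)
    c′∈F i = inF-neg (inF-* y∈F (c∈F (fsuc i)))
    head≈ : f fzero ≈ᵥ lcᵥ c′ (f ∘ fsuc)
    head≈ t = begin
      f fzero t                                      ≈⟨ *-identityˡ _ ⟨
      1# * f fzero t                                 ≈⟨ *-congʳ (trans (*-comm y (c fzero)) c₀y≈1) ⟨
      y * c fzero * f fzero t                        ≈⟨ *-assoc _ _ _ ⟩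
      y * (c fzero * f fzero t)                      ≈⟨ *-congˡ (inverseˡ-unique _ _ (cf≈0 t)) ⟩
      y * - lcᵥ (c ∘ fsuc) (f ∘ fsuc) t              ≈⟨ -‿distribʳ-* y _ ⟨
      - (y * lcᵥ (c ∘ fsuc) (f ∘ fsuc) t)            ≈⟨ -‿cong (*-lcᵥ y (c ∘ fsuc) (f ∘ fsuc) t) ⟩
      - lcᵥ (λ i → y * c (fsuc i)) (f ∘ fsuc) t      ≈⟨ -‿lcᵥ _ (f ∘ fsuc) t ⟩
      lcᵥ c′ (f ∘ fsuc) t                            ∎

  record IndependentSpanningSubfamily {N k} (w : Fin N → Vec k) : Set where
    constructor subfamily
    field
      size        : ℕ
      index       : Fin size → Fin N
      size≤N      : size ≤ N
      independent : Indepᵥ inF (w ∘ index)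
      spanning    : ∀ i → InSpanᵥ inF (w ∘ index) (w i)

  independentSpanningSubfamily : ∀ {N k} (w : Fin N → Vec k) → IndependentSpanningSubfamily w
  independentSpanningSubfamily {zero} w = subfamily 0 (λ ()) z≤n (λ _ _ _ ()) (λ ())
  independentSpanningSubfamily {suc N} w
    with independentSpanningSubfamily (w ∘ fsuc)
  ... | subfamily d index d≤N independent spanning
    with span? (w ∘ fsuc ∘ index) (w fzero)
  ...   | yes w₀∈span = subfamily d (fsuc ∘ index) (m≤n⇒m≤1+n d≤N) independent
                          λ { fzero → w₀∈span ; (fsuc i) → spanning i }
  ...   | no w₀∉span =
    subfamily (suc d) index′ (s≤s d≤N) (Indepᵥ-∷ (w ∘ index′) independent w₀∉span)
      λ { fzero    → InSpanᵥ-member inF inF-0 inF-1 (w ∘ index′) fzero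
        ; (fsuc i) → InSpanᵥ-tail inF inF-0 (w ∘ index′) (spanning i) }
    where
    index′ : Fin (suc d) → Fin (suc N)
    index′ = fzero ∷ (fsuc ∘ index)

  -- Sending t to the F_q-coordinates over c of ∑ t_j e_j is injective by independence of e,
  -- which gives q^N ≤ q^d.
  Indepᵥ-in-span⇒≤ : ∀ {N d k} (e : Fin N → Vec k) (c : Fin d → Vec k) → Indepᵥ inF e →
                     (∀ j → InSpanᵥ inF c (e j)) → N ≤ d
  Indepᵥ-in-span⇒≤ {N} {d} e c e-indep e∈span =
    ^-cancelʳ-≤ q 1<q (^-≤-by-injection coordinates coordinates-injective)
    where
    a : Fin N → Fin d → Carrier
    a j = proj₁ (e∈span j)

    image : (Fin N → Fin q) → Fin d → Carrier
    image t l = ∑ (λ j → enumF (t j) * a j l)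

    image-inF : ∀ t l → inF (image t l)
    image-inF t l = ∑-closed inF inF-0 inF-+ (λ j → inF-* (enumF-inF (t j)) (proj₁ (proj₂ (e∈span j)) l))

    coordinates : (Fin N → Fin q) → Fin d → Fin q
    coordinates t l = proj₁ (enumF-surj (image t l) (image-inF t l))

    te≈image : ∀ t → lcᵥ (enumF ∘ t) e ≈ᵥ lcᵥ (image t) c
    te≈image t = lcᵥ-∘ (enumF ∘ t) a c (λ j → proj₂ (proj₂ (e∈span j)))

    coordinates-correct : ∀ t l → enumF (coordinates t l) ≈ image t l
    coordinates-correct t l = proj₂ (enumF-surj (image t l) (image-inF t l))

    coordinates-injective : ∀ t t′ → coordinates t ≗ coordinates t′ → t ≗ t′
    coordinates-injective t t′ same j = enumF-inj _ _ (x∙y⁻¹≈ε⇒x≈y _ _ (e-indep _ difference-inF difference≈0 j))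
      where
      same-image : ∀ l → image t l ≈ image t′ l
      same-image l = trans (sym (coordinates-correct t l))
        (trans (reflexive (≡.cong enumF (same l))) (coordinates-correct t′ l))

      difference-inF : ∀ i → inF (enumF (t i) - enumF (t′ i))
      difference-inF i = inF-+ (enumF-inF _) (inF-neg (enumF-inF _))

      difference≈0 : lcᵥ (λ i → enumF (t i) - enumF (t′ i)) e ≈ᵥ (λ _ → 0#)
      difference≈0 x = trans (lcᵥ-sub _ _ e x) (x≈y⇒x∙y⁻¹≈ε (begin
        lcᵥ (enumF ∘ t) e x   ≈⟨ te≈image t x ⟩
        lcᵥ (image t) c x     ≈⟨ lcᵥ-cong c same-image x ⟩
        lcᵥ (image t′) c x    ≈⟨ te≈image t′ x ⟨
        lcᵥ (enumF ∘ t′) e x  ∎))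

  Indepᵥ⇒NonZeroᵥ : ∀ {d k} (s : Fin d → Vec k) → Indepᵥ inF s → ∀ j → NonZeroᵥ (s j)
  Indepᵥ⇒NonZeroᵥ s s-indep j sⱼ≈0 = 0≉1 (sym (≡.subst (_≈ 0#) (δ-diagonal j)
    (s-indep (δ j) (δ-closed inF inF-0 inF-1 j) (λ t → trans (sym (lcᵥ-δ j s t)) (sⱼ≈0 t)) j)))

  K-span-trans : ∀ {n d k} {w : Fin n → Vec k} {e : Fin d → Vec k} {v} →
                 InSpanᵥ (AnyK E) w v → (∀ i → InSpanᵥ inF e (w i)) → InSpanᵥ (AnyK E) e v
  K-span-trans {n} {d} {w = w} {e} (c , _ , v≈cw) w∈span =
    _ , (λ _ → 0#) , λ t → trans (v≈cw t) (lcᵥ-∘ c a e (λ i → proj₂ (proj₂ (w∈span i))) t)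
    where
    a : Fin n → Fin d → Carrier
    a i = proj₁ (w∈span i)

  module _ {n k : ℕ} (u : Fin n → Vec k) where

    SubspaceWitness : ℕ → Vec k → Set
    SubspaceWitness r v = Σ ℕ λ d → d ≤ r × Σ (Fin d → Vec k) λ s →
      Indepᵥ inF s × (∀ j → InU E u (s j)) × InSpanᵥ (AnyK E) s v

    span-of-U⇒SubspaceWitness : ∀ {d r v} (w : Fin d → Vec k) → d ≤ r → (∀ i → InU E u (w i)) →
                                InSpanᵥ (AnyK E) w v → SubspaceWitness r v
    span-of-U⇒SubspaceWitness w d≤r w∈U v∈span with independentSpanningSubfamily w
    ... | subfamily d′ index d′≤d independent spanning =
      d′ , ≤-trans d′≤d d≤r , w ∘ index , independent , w∈U ∘ index , K-span-trans v∈span spanning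

    -- The basis of S is padded to r + 1 points by repeating its first vector with coefficient 0.
    PropC-suc⇒SpansWith : ∀ r → PropC E u (suc r) → SpansWith E u r
    PropC-suc⇒SpansWith r C v v≉0 with C v
    ... | zero , _ , _ , _ , _ , (_ , _ , v≈0) = ⊥-elim (v≉0 v≈0)
    ... | suc d , 1+d≤1+r , s , s-indep , s∈U , (c , _ , v≈cs) =
      pad 1+d≤1+r s (s fzero) ,
      pad-all (λ w → InU E u w × NonZeroᵥ w) 1+d≤1+r point (point fzero) ,
      (pad 1+d≤1+r c 0# , (λ _ → 0#) , λ t → trans (v≈cs t) (sym (lcᵥ-pad 1+d≤1+r c s (s fzero) t)))
      where
      point : ∀ j → InU E u (s j) × NonZeroᵥ (s j)
      point j = s∈U j , Indepᵥ⇒NonZeroᵥ s s-indep j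

    SpansWith⇒PropC-suc : ∀ r → SpansWith E u r → PropC E u (suc r)
    SpansWith⇒PropC-suc r S v with v ≈ᵥ? (λ _ → 0#)
    ... | yes v≈0 = 0 , z≤n , (λ ()) , (λ _ _ _ ()) , (λ ()) , ((λ ()) , (λ ()) , v≈0)
    ... | no v≉0 with S v v≉0
    ...   | w , w∈U×w≉0 , v∈span =
      span-of-U⇒SubspaceWitness w ≤-refl (proj₁ ∘ w∈U×w≉0) v∈span

    PropC-suc⇔SpansWith : ∀ r → PropC E u (suc r) ⇔ SpansWith E u r
    PropC-suc⇔SpansWith r = mk⇔ (PropC-suc⇒SpansWith r) (SpansWith⇒PropC-suc r)

    -- If λ = a e with a over F_q, then v = ∑ λ_i u_i = ∑ e_j s_j where s_j = ∑ a_ij u_i ∈ U.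
    PropB⇒PropC : ∀ r → PropB E u r → PropC E u r
    PropB⇒PropC r B v with B v
    ... | λ′ , d , d≤r , (e , _ , _ , λ′∈span) , v≈λ′u =
      span-of-U⇒SubspaceWitness s d≤r s∈U (e , (λ _ → 0#) , v≈es)
      where
      a : Fin n → Fin d → Carrier
      a i = proj₁ (λ′∈span i)

      s : Fin d → Vec k
      s j = lcᵥ (λ i → a i j) u

      s∈U : ∀ j → InU E u (s j)
      s∈U j = (λ i → a i j) , (λ i → proj₁ (proj₂ (λ′∈span i)) j) , λ _ → refl

      λ′≈ea : ∀ i → λ′ i ≈ ∑ (λ j → e j * a i j)
      λ′≈ea i = trans (proj₂ (proj₂ (λ′∈span i))) (∑-cong {d} (λ j → *-comm _ _))

      v≈es : v ≈ᵥ lcᵥ e s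
      v≈es t = begin
        v t                                     ≈⟨ v≈λ′u t ⟩
        lcᵥ λ′ u t                              ≈⟨ lcᵥ-cong u λ′≈ea t ⟩
        lcᵥ (λ i → ∑ (λ j → e j * a i j)) u t   ≈⟨ lcᵥ-∘ e (λ j i → a i j) u (λ _ _ → refl) t ⟨
        lcᵥ e s t                               ∎

    -- If v = ∑ c_j s_j with s_j = ∑ a_ji u_i over F_q, then λ_i = ∑ c_j a_ji, and all λ_i lie in
    -- the F_q-span of c, which bounds wt_rk(λ) by d.
    PropC⇒PropB : ∀ r → PropC E u r → PropB E u r
    PropC⇒PropB r C v with C v
    ... | d , d≤r , s , _ , s∈U , (c , _ , v≈cs) with independentSpanningSubfamily ([_] ∘ λ′)
      where
      λ′ : Fin n → Carrier
      λ′ i = ∑ (λ j → c j * proj₁ (s∈U j) i)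
    ... | subfamily d′ index d′≤n independent spanning =
      λ′ , d′ , ≤-trans d′≤d d≤r ,
      (λ′ ∘ index , Indepᵥ-[] {inF} independent ,
       (λ j → InSpanᵥ-[] {inF} (InSpanᵥ-member inF inF-0 inF-1 ([_] ∘ λ′) (index j))) ,
       (λ i → InSpanᵥ-[] {inF} (spanning i))) ,
      (λ t → trans (v≈cs t) (lcᵥ-∘ c a u (λ j → proj₂ (proj₂ (s∈U j))) t))
      where
      a : Fin d → Fin n → Carrier
      a j = proj₁ (s∈U j)
      λ′ : Fin n → Carrier
      λ′ i = ∑ (λ j → c j * a j i)
      λ′∈span-c : ∀ i → InSpanᵥ inF ([_] ∘ c) [ λ′ i ]
      λ′∈span-c i = (λ j → a j i) , (λ j → proj₁ (proj₂ (s∈U j)) i) , λ _ → ∑-cong {d} (λ j → *-comm _ _)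
      d′≤d : d′ ≤ d
      d′≤d = Indepᵥ-in-span⇒≤ (([_] ∘ λ′) ∘ index) ([_] ∘ c) independent (λ′∈span-c ∘ index)

    PropB⇔PropC : ∀ r → PropB E u r ⇔ PropC E u r
    PropB⇔PropC r = mk⇔ (PropB⇒PropC r) (PropC⇒PropB r)

  ¬PropC-0 : ∀ {n k} (u : Fin n → Vec (suc k)) → ¬ PropC E u 0
  ¬PropC-0 u C with C (λ _ → 1#)
  ... | zero , z≤n , _ , _ , _ , (_ , _ , 1≈0) = 0≉1 (sym (1≈0 fzero))

  Least-cong : ∀ {P Q : ℕ → Set} → (∀ r → P r ⇔ Q r) → ∀ ρ → Least E P ρ ⇔ Least E Q ρ
  Least-cong P⇔Q ρ = mk⇔
    (λ (p , minimal) → Equivalence.to (P⇔Q ρ) p , λ r r<ρ q → minimal r r<ρ (Equivalence.from (P⇔Q r) q))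
    (λ (q , minimal) → Equivalence.from (P⇔Q ρ) q , λ r r<ρ p → minimal r r<ρ (Equivalence.to (P⇔Q r) p))

  Least-suc : ∀ {P : ℕ → Set} → ¬ P 0 → ∀ ρ → Least E P (suc ρ) ⇔ Least E (P ∘ suc) ρ
  Least-suc ¬P0 ρ = mk⇔
    (λ (p , minimal) → p , λ r r<ρ → minimal (suc r) (s≤s r<ρ))
    (λ (p , minimal) → p , λ { zero _ → ¬P0 ; (suc r) (s≤s r<ρ) → minimal r r<ρ })

theorem2p3 : (q m n k ρ : ℕ) → IsPrimePower q →
    1 ≤ m → 1 ≤ n → 1 ≤ k → 1 ≤ ρ →
    (E : FieldExt q m) → (u : Fin n → Lin.Vec (FieldExt.K E) k) →
    IsSystemBasis E u →
    (RankSaturating E u ρ ⇔ Least E (PropB E u) ρ) ×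
    (RankSaturating E u ρ ⇔ Least E (PropC E u) ρ)
theorem2p3 q m n (suc k) (suc ρ) _ _ _ _ _ E u _ = ⇔-trans saturating⇔C C⇔B , saturating⇔C
  where
  open FieldExtProperties E

  saturating⇔C : RankSaturating E u (suc ρ) ⇔ Least E (PropC E u) (suc ρ)
  saturating⇔C = ⇔-trans (Least-cong (λ r → ⇔-sym (PropC-suc⇔SpansWith u r)) ρ)
                          (⇔-sym (Least-suc (¬PropC-0 u) ρ))

  C⇔B : Least E (PropC E u) (suc ρ) ⇔ Least E (PropB E u) (suc ρ)
  C⇔B = Least-cong (λ r → ⇔-sym (PropB⇔PropC u r)) (suc ρ)
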